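{- For every positive integer $k$ and every graph $G$ of order greater than $1$, we have $\textnormal{ftdim}_k(G) \le \dim_k(G)\,(2+3^{\dim_k(G)-1})$.
   Context: Graphs are finite, simple, undirected, possibly disconnected; $\textnormal{dist}(u,v)=\infty$ between different components. For a positive integer $k$, a set $S=\{v_1,\dots,v_j\}$ of vertices is a $k$-truncated resolving set ($k$-resolving set) of $G$ if the vectors $(\min(k+1,\textnormal{dist}(u,v_1)),\dots,\min(k+1,\textnormal{dist}(u,v_j)))$ are pairwise distinct over $u\in V(G)$. The $k$-truncated metric dimension $\dim_k(G)$ is the minimum size of a $k$-resolving set. $\textnormal{ftdim}_k(G)$ is the minimum size of a nonempty $S\subseteq V(G)$ such that $S-\{s\}$ is a $k$-resolving set for every $s\in S$. -}

module Defs where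

open import Data.Nat using (ℕ; zero; suc; _≤_)
open import Data.Fin using (Fin)
open import Data.Fin.Subset using (Subset; _∈_; _-_; ∣_∣; Nonempty)
open import Data.Bool using (Bool; true; false)
open import Data.Product using (_×_)
open import Data.Sum using (_⊎_)
open import Relation.Binary.PropositionalEquality using (_≡_)

record Graph (n : ℕ) : Set where
  field
    adj   : Fin n → Fin n → Bool
    sym   : ∀ u v → adj u v ≡ adj v u
    irrfl : ∀ v → adj v v ≡ false
open Graph public

data Walk {n : ℕ} (G : Graph n) : Fin n → Fin n → ℕ → Set where
  nil  : ∀ {u} → Walk G u u 0
  cons : ∀ {u v w m} → adj G u v ≡ true → Walk G v w m → Walk G u w (suc m)

IsDist : ∀ {n} → Graph n → Fin n → Fin n → ℕ → Set
IsDist G u v d = Walk G u v d × (∀ m → Walk G u v m → d ≤ m)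

-- min(k+1, dist(u,v)) = t   (dist = ∞ between different components)
TDist : ∀ {n} → Graph n → ℕ → Fin n → Fin n → ℕ → Set
TDist G k u v t =
  (t ≤ k × IsDist G u v t) ⊎ (t ≡ suc k × (∀ m → Walk G u v m → suc k ≤ m))

IsKResolving : ∀ {n} → Graph n → ℕ → Subset n → Set
IsKResolving {n} G k S =
  ∀ (u w : Fin n) →
  (∀ s → s ∈ S → ∀ t → TDist G k u s t → TDist G k w s t) → u ≡ w

IsDimK : ∀ {n} → Graph n → ℕ → ℕ → Set
IsDimK {n} G k d =
  (Data.Product.Σ (Subset n) λ S → IsKResolving G k S × ∣ S ∣ ≡ d)
  × (∀ S → IsKResolving G k S → d ≤ ∣ S ∣)

IsFaultTolerantKResolving : ∀ {n} → Graph n → ℕ → Subset n → Set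
IsFaultTolerantKResolving G k S =
  Nonempty S × (∀ s → s ∈ S → IsKResolving G k (S - s))

-- Let S be a k-truncated resolving set with |S| = d. For s ∈ S let N s be the
-- neighbourhood of s and W s the set of vertices w ≠ s that no vertex of (S - s) ∪ N s
-- distinguishes from s. Then T = ⋃_{s ∈ S} ({s} ∪ N s ∪ W s) is fault-tolerant: if u, w
-- are not separated by T - z with z ∈ S, then on a shortest walk from u to z the last
-- vertex before z lies in N z ⊆ T - z, which forces d_k(w,z) ≤ d_k(u,z), unless u = z, in
-- which case w ∈ W z ⊆ T - z forces w = z. The bound comes from |W s| ≤ 1 and
-- |N s| ≤ 3^(d-1): a neighbour x of s is determined by the distances d_k(x,p) for
-- p ∈ S - s, each of which lies within 1 of d_k(s,p).
module Submission where

open import Defs renaming (sym to adj-sym)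
open import Data.Nat using (ℕ; zero; suc; _≤_; _<_; _*_; _+_; _∸_; _^_; z≤n; s≤s)
open import Data.Nat.Properties
open import Data.Fin using (Fin; zero; suc; toℕ)
open import Data.Fin.Properties using (any?; toℕ-fromℕ<)
open import Data.Fin.Subset
open import Data.Fin.Subset.Properties
open import Data.Vec using (_∷_; []; here; there; tabulate)
open import Data.Vec.Properties using (lookup∘tabulate; []=⇒lookup; lookup⇒[]=)
open import Data.Bool using (true)
open import Data.Product using (Σ; _×_; _,_; proj₁; proj₂; map₂)
open import Data.Sum using (_⊎_; inj₁; inj₂)
open import Function using (_∘_)
open import Relation.Nullary using (Dec; yes; no; does; contradiction)
open import Relation.Nullary.Decidable using (_×-dec_; ¬?; dec-true)
open import Relation.Binary.PropositionalEquality
import Data.Bool.Properties as Bool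
import Data.Fin.Properties as Fin

private
  variable
    m n : ℕ

satisfying : {P : Fin n → Set} → ((x : Fin n) → Dec (P x)) → Subset n
satisfying P? = tabulate (does ∘ P?)

∈-satisfying⁺ : {P : Fin n → Set} (P? : (x : Fin n) → Dec (P x)) {x : Fin n} →
                P x → x ∈ satisfying P?
∈-satisfying⁺ P? {x} px =
  lookup⇒[]= x _ (trans (lookup∘tabulate _ x) (dec-true (P? x) px))

∈-satisfying⁻ : {P : Fin n → Set} (P? : (x : Fin n) → Dec (P x)) {x : Fin n} →
                x ∈ satisfying P? → P x
∈-satisfying⁻ P? {x} x∈ = witness (P? x) (trans (sym (lookup∘tabulate _ x)) ([]=⇒lookup x∈))
  where
  witness : ∀ {A : Set} (a? : Dec A) → does a? ≡ true → A
  witness (yes a) _ = a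

x∈p-y⇒x≢y : {p : Subset n} {x y : Fin n} → x ∈ p - y → x ≢ y
x∈p-y⇒x≢y {p = p} {x} x∈ refl = ∉─ p ⁅ x ⁆ x∈ (x∈⁅x⁆ x)
  where
  ∉─ : ∀ {m} {x : Fin m} (p q : Subset m) → x ∈ p ─ q → x ∉ q
  ∉─ (_ ∷ p) (_ ∷ q) (there x∈) (there x∈q) = ∉─ p q x∈ x∈q

∣p∪q∣≤∣p∣+∣q∣ : (p q : Subset n) → ∣ p ∪ q ∣ ≤ ∣ p ∣ + ∣ q ∣
∣p∪q∣≤∣p∣+∣q∣ [] [] = z≤n
∣p∪q∣≤∣p∣+∣q∣ (inside ∷ p) (inside ∷ q) =
  s≤s (≤-trans (∣p∪q∣≤∣p∣+∣q∣ p q) (+-monoʳ-≤ ∣ p ∣ (n≤1+n ∣ q ∣)))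
∣p∪q∣≤∣p∣+∣q∣ (inside ∷ p) (outside ∷ q) = s≤s (∣p∪q∣≤∣p∣+∣q∣ p q)
∣p∪q∣≤∣p∣+∣q∣ (outside ∷ p) (inside ∷ q) =
  ≤-trans (s≤s (∣p∪q∣≤∣p∣+∣q∣ p q)) (≤-reflexive (sym (+-suc ∣ p ∣ ∣ q ∣)))
∣p∪q∣≤∣p∣+∣q∣ (outside ∷ p) (outside ∷ q) = ∣p∪q∣≤∣p∣+∣q∣ p q

⋃[_]_ : Subset m → (Fin m → Subset n) → Subset n
⋃[ [] ] C = ⊥
⋃[ inside ∷ P ] C = C zero ∪ ⋃[ P ] (C ∘ suc)
⋃[ outside ∷ P ] C = ⋃[ P ] (C ∘ suc)

⊆-⋃ : {P : Subset m} {C : Fin m → Subset n} {p : Fin m} → p ∈ P → C p ⊆ ⋃[ P ] C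
⊆-⋃ {P = inside ∷ P} here = p⊆p∪q _
⊆-⋃ {P = inside ∷ P} {C} (there p∈) x∈ = q⊆p∪q (C zero) _ (⊆-⋃ p∈ x∈)
⊆-⋃ {P = outside ∷ P} (there p∈) = ⊆-⋃ p∈

∣⋃∣≤∣P∣*b : {b : ℕ} (P : Subset m) (C : Fin m → Subset n) →
            (∀ {p} → p ∈ P → ∣ C p ∣ ≤ b) → ∣ ⋃[ P ] C ∣ ≤ ∣ P ∣ * b
∣⋃∣≤∣P∣*b {n = n} [] C _ = ≤-reflexive (∣⊥∣≡0 n)
∣⋃∣≤∣P∣*b (inside ∷ P) C bound = ≤-trans (∣p∪q∣≤∣p∣+∣q∣ (C zero) _)
  (+-mono-≤ (bound here) (∣⋃∣≤∣P∣*b P (C ∘ suc) (bound ∘ there)))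
∣⋃∣≤∣P∣*b (outside ∷ P) C bound = ∣⋃∣≤∣P∣*b P (C ∘ suc) (bound ∘ there)

∣p∣≤1 : (p : Subset n) → (∀ {x y} → x ∈ p → y ∈ p → x ≡ y) → ∣ p ∣ ≤ 1
∣p∣≤1 {n} p all-equal with nonempty? p
... | yes (x , x∈) = ≤-trans (p⊆q⇒∣p∣≤∣q∣ (λ y∈ → subst (_∈ ⁅ x ⁆) (all-equal x∈ y∈) (x∈⁅x⁆ x)))
                             (≤-reflexive (∣⁅x⁆∣≡1 x))
... | no empty = ≤-trans (≤-reflexive (trans (cong ∣_∣ (Empty-unique empty)) (∣⊥∣≡0 n))) z≤n

∣A∣≤b^∣P∣ : (b : ℕ) (P : Subset m) (c : Fin m → Fin n → ℕ) (A : Subset n) →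
            (∀ {p x} → p ∈ P → x ∈ A → c p x < b) →
            (∀ {x y} → x ∈ A → y ∈ A → Lift (λ p → c p x ≡ c p y) P → x ≡ y) →
            ∣ A ∣ ≤ b ^ ∣ P ∣
∣A∣≤b^∣P∣ b [] c A _ separates = ∣p∣≤1 A (λ x∈ y∈ → separates x∈ y∈ λ ())
∣A∣≤b^∣P∣ b (outside ∷ P) c A bounded separates =
  ∣A∣≤b^∣P∣ b P (c ∘ suc) A (bounded ∘ there) λ x∈ y∈ agree → separates x∈ y∈ λ { (there p∈) → agree p∈ }
∣A∣≤b^∣P∣ {n = n} b (inside ∷ P) c A bounded separates = begin
  ∣ A ∣                    ≤⟨ p⊆q⇒∣p∣≤∣q∣ A⊆⋃fibres ⟩
  ∣ ⋃[ ⊤ ] fibre ∣         ≤⟨ ∣⋃∣≤∣P∣*b ⊤ fibre (λ _ → ∣fibre∣≤) ⟩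
  ∣ ⊤ {b} ∣ * b ^ ∣ P ∣    ≡⟨ cong (_* b ^ ∣ P ∣) (∣⊤∣≡n b) ⟩
  b ^ ∣ inside ∷ P ∣       ∎
  where
  open ≤-Reasoning
  labelled? : (i : Fin b) (x : Fin n) → Dec (c zero x ≡ toℕ i)
  labelled? i x = c zero x ≟ toℕ i
  fibre : Fin b → Subset n
  fibre i = A ∩ satisfying (labelled? i)
  A⊆⋃fibres : A ⊆ ⋃[ ⊤ ] fibre
  A⊆⋃fibres x∈ = ⊆-⋃ {C = fibre} ∈⊤
    (x∈p∩q⁺ (x∈ , ∈-satisfying⁺ (labelled? _) (sym (toℕ-fromℕ< (bounded here x∈)))))
  ∣fibre∣≤ : ∀ {i} → ∣ fibre i ∣ ≤ b ^ ∣ P ∣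
  ∣fibre∣≤ {i} = ∣A∣≤b^∣P∣ b P (c ∘ suc) (fibre i) (λ p∈ x∈ → bounded (there p∈) (in-A x∈))
    λ x∈ y∈ agree → separates (in-A x∈) (in-A y∈)
      λ { here → trans (label x∈) (sym (label y∈)) ; (there p∈) → agree p∈ }
    where
    in-A : ∀ {x} → x ∈ fibre i → x ∈ A
    in-A = proj₁ ∘ x∈p∩q⁻ A _
    label : ∀ {x} → x ∈ fibre i → c zero x ≡ toℕ i
    label = ∈-satisfying⁻ (labelled? i) ∘ proj₂ ∘ x∈p∩q⁻ A _

least-or-above : {P : ℕ → Set} → ((m : ℕ) → Dec (P m)) → (b : ℕ) →
                 (Σ ℕ λ t → t ≤ b × P t × (∀ m → P m → t ≤ m)) ⊎ (∀ m → P m → b < m)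
least-or-above P? zero with P? zero
... | yes p₀ = inj₁ (zero , z≤n , p₀ , λ _ _ → z≤n)
... | no ¬p₀ = inj₂ λ { zero p₀ → contradiction p₀ ¬p₀ ; (suc m) _ → s≤s z≤n }
least-or-above P? (suc b) with least-or-above P? b
... | inj₁ (t , t≤b , pt , least) = inj₁ (t , m≤n⇒m≤1+n t≤b , pt , least)
... | inj₂ above with P? (suc b)
...   | yes p = inj₁ (suc b , ≤-refl , p , above)
...   | no ¬p = inj₂ λ m pm → ≤∧≢⇒< (above m pm) λ { refl → ¬p pm }

module _ {n : ℕ} (G : Graph n) where

  walk? : ∀ m u v → Dec (Walk G u v m)
  walk? zero u v with u Fin.≟ v
  ... | yes refl = yes nil
  ... | no u≢v = no λ { nil → u≢v refl }
  walk? (suc m) u v with any? (λ x → (adj G u x Bool.≟ true) ×-dec walk? m x v)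
  ... | yes (x , edge , walk) = yes (cons edge walk)
  ... | no none = no λ { (cons edge walk) → none (_ , edge , walk) }

  snoc : ∀ {u x v m} → Walk G u x m → adj G x v ≡ true → Walk G u v (suc m)
  snoc nil edge = cons edge nil
  snoc (cons edge′ walk) edge = cons edge′ (snoc walk edge)

  unsnoc : ∀ {u v m} → Walk G u v (suc m) → Σ (Fin n) λ x → Walk G u x m × adj G x v ≡ true
  unsnoc (cons edge nil) = _ , nil , edge
  unsnoc (cons edge walk@(cons _ _)) with unsnoc walk
  ... | x , walk′ , edge′ = x , cons edge walk′ , edge′

  adj⇒≢ : ∀ {u v} → adj G u v ≡ true → u ≢ v
  adj⇒≢ {u} edge refl with trans (sym edge) (irrfl G u)
  ... | ()

  N : Fin n → Subset n
  N s = satisfying (λ x → adj G s x Bool.≟ true)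

  ∈N⁺ : ∀ {s x} → adj G s x ≡ true → x ∈ N s
  ∈N⁺ {s} = ∈-satisfying⁺ (λ x → adj G s x Bool.≟ true)

  ∈N⁻ : ∀ {s x} → x ∈ N s → adj G s x ≡ true
  ∈N⁻ {s} = ∈-satisfying⁻ (λ x → adj G s x Bool.≟ true)

module TruncatedDistance {n : ℕ} (G : Graph n) (k : ℕ) where

  tdist : ∀ u v → Σ ℕ (TDist G k u v)
  tdist u v with least-or-above (λ m → walk? G m u v) k
  ... | inj₁ (t , t≤k , walk , least) = t , inj₁ (t≤k , walk , least)
  ... | inj₂ above = suc k , inj₂ (refl , above)

  td : Fin n → Fin n → ℕ
  td u v = proj₁ (tdist u v)

  td-TDist : ∀ u v → TDist G k u v (td u v)
  td-TDist u v = proj₂ (tdist u v)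

  TDist-unique : ∀ {u v t t′} → TDist G k u v t → TDist G k u v t′ → t ≡ t′
  TDist-unique (inj₁ (_ , walk , least)) (inj₁ (_ , walk′ , least′)) =
    ≤-antisym (least _ walk′) (least′ _ walk)
  TDist-unique (inj₁ (t≤k , walk , _)) (inj₂ (refl , far)) = contradiction (≤-trans (far _ walk) t≤k) (n≮n _)
  TDist-unique (inj₂ (refl , far)) (inj₁ (t≤k , walk , _)) = contradiction (≤-trans (far _ walk) t≤k) (n≮n _)
  TDist-unique (inj₂ (refl , _)) (inj₂ (refl , _)) = refl

  td≤length : ∀ {u v m} → Walk G u v m → td u v ≤ m
  td≤length {u} {v} walk with td-TDist u v
  ... | inj₁ (_ , _ , least) = least _ walk
  ... | inj₂ (eq , far) = subst (_≤ _) (sym eq) (far _ walk)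

  td-walk : ∀ {u v} → td u v ≤ k → Walk G u v (td u v)
  td-walk {u} {v} td≤k with td-TDist u v
  ... | inj₁ (_ , walk , _) = walk
  ... | inj₂ (eq , _) = contradiction (subst (_≤ k) eq td≤k) (n≮n k)

  td≤1+k : ∀ u v → td u v ≤ suc k
  td≤1+k u v with td-TDist u v
  ... | inj₁ (t≤k , _ , _) = m≤n⇒m≤1+n t≤k
  ... | inj₂ (eq , _) = ≤-reflexive eq

  td-refl : ∀ u → td u u ≡ 0
  td-refl u = n≤0⇒n≡0 (td≤length (nil {u = u}))

  td≡0⇒≡ : ∀ {u v} → td u v ≡ 0 → u ≡ v
  td≡0⇒≡ {u} {v} eq = walk₀⇒≡ (subst (Walk G u v) eq (td-walk (subst (_≤ k) (sym eq) z≤n)))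
    where
    walk₀⇒≡ : Walk G u v 0 → u ≡ v
    walk₀⇒≡ nil = refl

  td-stepˡ : ∀ {x y} v → adj G x y ≡ true → td x v ≤ suc (td y v)
  td-stepˡ {x} {y} v edge with td y v ≤? k
  ... | yes td≤k = td≤length (cons edge (td-walk td≤k))
  ... | no td≰k = ≤-trans (td≤1+k x v) (m≤n⇒m≤1+n (≰⇒> td≰k))

  td-stepʳ : ∀ {x y} u → adj G x y ≡ true → td u y ≤ suc (td u x)
  td-stepʳ {x} {y} u edge with td u x ≤? k
  ... | yes td≤k = td≤length (snoc G (td-walk td≤k) edge)
  ... | no td≰k = ≤-trans (td≤1+k u y) (m≤n⇒m≤1+n (≰⇒> td≰k))

  adj⇒td≡1 : ∀ {x y} → adj G x y ≡ true → td x y ≡ 1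
  adj⇒td≡1 {x} {y} edge = ≤-antisym (td≤length (cons edge nil)) (n≢0⇒n>0 (adj⇒≢ G edge ∘ td≡0⇒≡))

  Agree : Subset n → Fin n → Fin n → Set
  Agree A u w = Lift (λ p → td u p ≡ td w p) A

  agree? : ∀ A u w → Dec (Agree A u w)
  agree? A u w = Lift? (λ p → td u p ≟ td w p) A

  agree-sym : ∀ {A u w} → Agree A u w → Agree A w u
  agree-sym agree = sym ∘ agree

  agree-trans : ∀ {A u v w} → Agree A u v → Agree A v w → Agree A u w
  agree-trans uv vw p∈ = trans (uv p∈) (vw p∈)

  agree-⊆ : ∀ {A B u w} → A ⊆ B → Agree B u w → Agree A u w
  agree-⊆ A⊆B agree = agree ∘ A⊆B

  agree-insert : ∀ {A s u w} → Agree (A - s) u w → (s ∈ A → td u s ≡ td w s) → Agree A u w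
  agree-insert {s = s} agree at-s {p} p∈ with p Fin.≟ s
  ... | yes refl = at-s p∈
  ... | no p≢s = agree (x∈p∧x≢y⇒x∈p-y p∈ p≢s)

  Resolving : Subset n → Set
  Resolving S = ∀ {u w} → Agree S u w → u ≡ w

  IsKResolving⇒Resolving : ∀ {S} → IsKResolving G k S → Resolving S
  IsKResolving⇒Resolving resolving {u} {w} agree = resolving u w λ p p∈ t tdist →
    subst (TDist G k w p) (sym (trans (TDist-unique tdist (td-TDist u p)) (agree p∈))) (td-TDist w p)

  Resolving⇒IsKResolving : ∀ {S} → Resolving S → IsKResolving G k S
  Resolving⇒IsKResolving resolving u w same = resolving λ {p} p∈ →
    TDist-unique (same p p∈ (td u p) (td-TDist u p)) (td-TDist w p)

  agree-on-N⇒td≤ : ∀ {u w z} → u ≢ z → Agree (N G z) u w → td w z ≤ td u z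
  agree-on-N⇒td≤ {u} {w} {z} u≢z agree with td u z ≤? k
  ... | yes td≤k = via-last-edge (td-walk td≤k)
    where
    via-last-edge : ∀ {m} → Walk G u z m → td w z ≤ m
    via-last-edge nil = contradiction refl u≢z
    via-last-edge walk@(cons _ _) with unsnoc G walk
    ... | x , walk′ , edge = begin
      td w z        ≤⟨ td-stepʳ w edge ⟩
      suc (td w x)  ≡⟨ cong suc (agree (∈N⁺ G (trans (adj-sym G z x) edge))) ⟨
      suc (td u x)  ≤⟨ s≤s (td≤length walk′) ⟩
      suc _         ∎
      where open ≤-Reasoning
  ... | no td≰k = ≤-trans (td≤1+k w z) (≰⇒> td≰k)

  Resolving⇒Nonempty : 2 ≤ n → ∀ {S} → Resolving S → Nonempty S
  Resolving⇒Nonempty (s≤s (s≤s _)) {S} resolving with nonempty? S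
  ... | yes nonempty = nonempty
  ... | no empty = contradiction (resolving {zero} {suc zero} λ p∈ → contradiction (_ , p∈) empty) λ ()

module FaultTolerantExtension {n : ℕ} (G : Graph n) (k : ℕ)
                              (S : Subset n) (resolving : TruncatedDistance.Resolving G k S) where
  open TruncatedDistance G k

  Twin : Fin n → Fin n → Set
  Twin s w = w ≢ s × Agree (S - s) w s × Agree (N G s) w s

  twin? : ∀ s w → Dec (Twin s w)
  twin? s w = ¬? (w Fin.≟ s) ×-dec (agree? (S - s) w s ×-dec agree? (N G s) w s)

  W : Fin n → Subset n
  W s = satisfying (twin? s)

  C : Fin n → Subset n
  C s = ⁅ s ⁆ ∪ (N G s ∪ W s)

  T : Subset n
  T = ⋃[ S ] C

  ∣N∣≤3^∣S-s∣ : ∀ s → ∣ N G s ∣ ≤ 3 ^ ∣ S - s ∣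
  ∣N∣≤3^∣S-s∣ s = ∣A∣≤b^∣P∣ 3 (S - s) shift (N G s) shift<3 shift-separates
    where
    shift : Fin n → Fin n → ℕ
    shift p x = suc (td x p) ∸ td s p
    edge : ∀ {x} → x ∈ N G s → adj G x s ≡ true
    edge {x} x∈ = trans (adj-sym G x s) (∈N⁻ G x∈)
    shift<3 : ∀ {p x} → p ∈ S - s → x ∈ N G s → shift p x < 3
    shift<3 {p} _ x∈ = s≤s (≤-trans (∸-monoˡ-≤ (td s p) (s≤s (td-stepˡ p (edge x∈))))
                                    (≤-reflexive (m+n∸n≡m 2 (td s p))))
    shift-separates : ∀ {x y} → x ∈ N G s → y ∈ N G s →
                      Lift (λ p → shift p x ≡ shift p y) (S - s) → x ≡ y
    shift-separates x∈ y∈ same = resolving (agree-insert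
      (λ {p} p∈ → suc-injective (∸-cancelʳ-≡ (td-stepˡ p (∈N⁻ G x∈)) (td-stepˡ p (∈N⁻ G y∈)) (same p∈)))
      (λ _ → trans (adj⇒td≡1 (edge x∈)) (sym (adj⇒td≡1 (edge y∈)))))

  ∣W∣≤1 : ∀ s → ∣ W s ∣ ≤ 1
  ∣W∣≤1 s = ∣p∣≤1 (W s) λ x∈ y∈ → twins-equal (∈-satisfying⁻ (twin? s) x∈) (∈-satisfying⁻ (twin? s) y∈)
    where
    twins-equal : ∀ {x y} → Twin s x → Twin s y → x ≡ y
    twins-equal (x≢s , xS , xN) (y≢s , yS , yN) = resolving (agree-insert
      (agree-trans xS (agree-sym yS))
      (λ _ → ≤-antisym (agree-on-N⇒td≤ y≢s (agree-trans yN (agree-sym xN)))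
                       (agree-on-N⇒td≤ x≢s (agree-trans xN (agree-sym yN)))))

  ∣C∣≤2+3^[∣S∣∸1] : ∀ {s} → s ∈ S → ∣ C s ∣ ≤ 2 + 3 ^ (∣ S ∣ ∸ 1)
  ∣C∣≤2+3^[∣S∣∸1] {s} s∈ = begin
    ∣ ⁅ s ⁆ ∪ (N G s ∪ W s) ∣         ≤⟨ ∣p∪q∣≤∣p∣+∣q∣ ⁅ s ⁆ _ ⟩
    ∣ ⁅ s ⁆ ∣ + ∣ N G s ∪ W s ∣       ≤⟨ +-mono-≤ (≤-reflexive (∣⁅x⁆∣≡1 s)) (∣p∪q∣≤∣p∣+∣q∣ (N G s) (W s)) ⟩
    1 + (∣ N G s ∣ + ∣ W s ∣)         ≤⟨ s≤s (+-mono-≤ ∣N∣≤ (∣W∣≤1 s)) ⟩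
    1 + (3 ^ (∣ S ∣ ∸ 1) + 1)         ≡⟨ cong suc (+-comm (3 ^ (∣ S ∣ ∸ 1)) 1) ⟩
    2 + 3 ^ (∣ S ∣ ∸ 1)               ∎
    where
    open ≤-Reasoning
    ∣S-s∣≤∣S∣∸1 : ∣ S - s ∣ ≤ ∣ S ∣ ∸ 1
    ∣S-s∣≤∣S∣∸1 = subst (∣ S - s ∣ ≤_) (pred[m∸n]≡m∸[1+n] ∣ S ∣ 0) (<⇒≤pred (x∈p⇒∣p-x∣<∣p∣ s∈))
    ∣N∣≤ : ∣ N G s ∣ ≤ 3 ^ (∣ S ∣ ∸ 1)
    ∣N∣≤ = ≤-trans (∣N∣≤3^∣S-s∣ s) (^-monoʳ-≤ 3 ∣S-s∣≤∣S∣∸1)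

  ∣T∣≤∣S∣*[2+3^[∣S∣∸1]] : ∣ T ∣ ≤ ∣ S ∣ * (2 + 3 ^ (∣ S ∣ ∸ 1))
  ∣T∣≤∣S∣*[2+3^[∣S∣∸1]] = ∣⋃∣≤∣P∣*b S C ∣C∣≤2+3^[∣S∣∸1]

  C⊆T : ∀ {s} → s ∈ S → C s ⊆ T
  C⊆T = ⊆-⋃ {C = C}

  S⊆T : S ⊆ T
  S⊆T {s} s∈ = C⊆T s∈ (x∈p∪q⁺ (inj₁ (x∈⁅x⁆ s)))

  S-z⊆T-z : ∀ {z} → S - z ⊆ T - z
  S-z⊆T-z p∈ = x∈p∧x≢y⇒x∈p-y (S⊆T (p─q⊆p S _ p∈)) (x∈p-y⇒x≢y p∈)

  N⊆T-z : ∀ {z} → z ∈ S → N G z ⊆ T - z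
  N⊆T-z z∈ x∈ = x∈p∧x≢y⇒x∈p-y (C⊆T z∈ (x∈p∪q⁺ (inj₂ (x∈p∪q⁺ (inj₁ x∈))))) (adj⇒≢ G (∈N⁻ G x∈) ∘ sym)

  W⊆T-z : ∀ {z} → z ∈ S → W z ⊆ T - z
  W⊆T-z z∈ w∈ = x∈p∧x≢y⇒x∈p-y (C⊆T z∈ (x∈p∪q⁺ (inj₂ (x∈p∪q⁺ (inj₂ w∈)))))
                              (proj₁ (∈-satisfying⁻ (twin? _) w∈))

  agree-with-z⇒≡z : ∀ {z w} → z ∈ S → Agree (T - z) z w → w ≡ z
  agree-with-z⇒≡z {z} {w} z∈ agree with w Fin.≟ z
  ... | yes w≡z = w≡z
  ... | no w≢z = contradiction (sym (td≡0⇒≡ (trans (agree (W⊆T-z z∈ w∈W)) (td-refl w)))) w≢z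
    where
    w∈W : w ∈ W z
    w∈W = ∈-satisfying⁺ (twin? z)
      (w≢z , agree-sym (agree-⊆ S-z⊆T-z agree) , agree-sym (agree-⊆ (N⊆T-z z∈) agree))

  agree-at-z : ∀ {z u w} → z ∈ S → Agree (T - z) u w → td u z ≡ td w z
  agree-at-z {z} {u} {w} z∈ agree with u Fin.≟ z | w Fin.≟ z
  ... | yes refl | _ = cong (λ v → td v z) (sym (agree-with-z⇒≡z z∈ agree))
  ... | _ | yes refl = cong (λ v → td v z) (agree-with-z⇒≡z z∈ (agree-sym agree))
  ... | no u≢z | no w≢z = ≤-antisym (agree-on-N⇒td≤ w≢z (agree-sym agreeN)) (agree-on-N⇒td≤ u≢z agreeN)
    where
    agreeN : Agree (N G z) u w
    agreeN = agree-⊆ (N⊆T-z z∈) agree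

  T-z-resolving : ∀ z → Resolving (T - z)
  T-z-resolving z agree = resolving (agree-insert (agree-⊆ S-z⊆T-z agree) (λ z∈ → agree-at-z z∈ agree))

theorem23 : (k : ℕ) → 1 ≤ k → (n : ℕ) → 2 ≤ n → (G : Graph n) → (d : ℕ) → IsDimK G k d →
    Σ (Subset n) (λ T → IsFaultTolerantKResolving G k T × ∣ T ∣ ≤ d * (2 + 3 ^ (d ∸ 1)))
theorem23 k _ n 2≤n G d ((S , S-resolving , ∣S∣≡d) , _) =
  T , (map₂ S⊆T (Resolving⇒Nonempty 2≤n resolving) ,
       λ z _ → Resolving⇒IsKResolving (T-z-resolving z)) ,
  subst (λ m → ∣ T ∣ ≤ m * (2 + 3 ^ (m ∸ 1))) ∣S∣≡d ∣T∣≤∣S∣*[2+3^[∣S∣∸1]]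
  where
  open TruncatedDistance G k
  resolving : Resolving S
  resolving = IsKResolving⇒Resolving S-resolving
  open FaultTolerantExtension G k S resolving
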